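{- Let $r\ge 2$ and $h\ge 1$ be integers. Let $X_1X_2\ldots$ be an infinite random word over the alphabet $\{1,\dots,r\}$ whose letters are i.i.d.\ and uniformly distributed, i.e.\ $\mathbb{P}\{X_k=i\}=1/r$ for all $i$. Let $B_r$ be the smallest $n$ such that every letter $1,\dots,r$ has an $h$-run in $X_1\ldots X_n$. Then \[ \mathbb{E}(B_r)=\frac{r(r^h-1)}{r-1}H_r, \] where $H_r=\sum_{k=1}^r\frac1k$ is the $r$th harmonic number.
   Context: A letter $\ell$ has an $h$-run in a finite word $w$ if the word $\ell^h$ ($h$ consecutive copies of $\ell$) is a factor (contiguous subword) of $w$. -}

module Defs where

open import Data.Nat as ℕ using (ℕ; zero; suc; _^_; _<_; _≤_)
open import Data.Nat.Properties using (_≟_; m^n≢0)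
open import Data.Fin as Fin using (Fin)
open import Data.Fin.Properties as FinP using ()
open import Data.List using (List; []; _∷_; replicate; take; length; filter; map; concatMap; allFin; upTo)
open import Data.List.Relation.Binary.Infix.Heterogeneous using (Infix)
open import Data.List.Relation.Binary.Infix.Heterogeneous.Properties using (infix?)
open import Data.List.Relation.Unary.All using (All)
open import Data.List.Relation.Unary.All.Properties using (all-upTo)
import Data.List.Relation.Unary.All as All
open import Data.Product using (_×_; ∃-syntax; Σ-syntax)
open import Data.Integer using (+_)
open import Data.Rational as ℚ using (ℚ; _+_; _*_; _-_; ∣_∣; 0ℚ; 1ℚ)
open import Relation.Binary.PropositionalEquality using (_≡_)
open import Relation.Nullary using (Dec; ¬_)
open import Relation.Nullary.Decidable using (_×-dec_; ¬?)

Word : ℕ → Set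
Word r = List (Fin r)

words : (r n : ℕ) → List (Word r)
words r zero    = [] ∷ []
words r (suc n) = concatMap (λ w → map (λ a → a ∷ w) (allFin r)) (words r n)

HasRun : {r : ℕ} (h : ℕ) (ℓ : Fin r) (w : Word r) → Set
HasRun h ℓ w = Infix _≡_ (replicate h ℓ) w

hasRun? : {r : ℕ} (h : ℕ) (ℓ : Fin r) (w : Word r) → Dec (HasRun h ℓ w)
hasRun? h ℓ w = infix? FinP._≟_ (replicate h ℓ) w

AllRuns : (r h : ℕ) (w : Word r) → Set
AllRuns r h w = All (λ ℓ → HasRun h ℓ w) (allFin r)

allRuns? : (r h : ℕ) (w : Word r) → Dec (AllRuns r h w)
allRuns? r h w = All.all? (λ ℓ → hasRun? h ℓ w) (allFin r)

StopsAt : (r h n : ℕ) (w : Word r) → Set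
StopsAt r h n w = AllRuns r h (take n w) × All (λ m → ¬ AllRuns r h (take m w)) (upTo n)

stopsAt? : (r h n : ℕ) (w : Word r) → Dec (StopsAt r h n w)
stopsAt? r h n w = allRuns? r h (take n w) ×-dec All.all? (λ m → ¬? (allRuns? r h (take m w))) (upTo n)

-- P{B_r = n} = #{ words x₁…xₙ with B = n } / r^n
-- (the event {B = n} depends only on X₁…Xₙ, and every word of length n has
-- probability r^{-n} under the i.i.d. uniform law).
countStops : (r h n : ℕ) → ℕ
countStops r h n = length (filter (stopsAt? r h n) (words r n))

probB : (r h n : ℕ) → .{{_ : ℕ.NonZero r}} → ℚ
probB r h n {{nz}} = (+ countStops r h n) ℚ./ (r ^ n)
  where instance _ : ℕ.NonZero (r ^ n)
                 _ = m^n≢0 r n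

partialSum : (ℕ → ℚ) → ℕ → ℚ
partialSum f zero    = 0ℚ
partialSum f (suc N) = partialSum f N + f N

SeriesSumsTo : (ℕ → ℚ) → ℚ → Set
SeriesSumsTo f L = ∀ (ε : ℚ) → 0ℚ ℚ.< ε →
  ∃[ N ] (∀ n → N ≤ n → ∣ partialSum f n - L ∣ ℚ.< ε)

harmonic : ℕ → ℚ
harmonic r = partialSum (λ k → (+ 1) ℚ./ suc k) r

-- Let #unfinished n be the number of words of length n in which some letter still lacks an
-- h-run, so that P{B > n} = #unfinished n / r^n.  A word stops at n + 1 exactly when it is
-- unfinished at n but not at n + 1, whence countStops (n + 1) + #unfinished (n + 1) =
-- r · #unfinished n, and the series of the P{B = n} telescopes to 1 − #unfinished n / r^n.
--
-- For the expectation, let Ψ w be r! times the expected number of letters still to be read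
-- after w, which a coupon-collector computation gives in closed form.  It satisfies the
-- one-step equation r Ψ w = r · r! + Σ_a Ψ (a w) for unfinished w, so the series of the
-- n P{B = n} telescopes to E − (Σ_{|w| = n} Ψ w + r! n #unfinished n) / (r! r^n), where
-- E = Ψ [] / r! = r (r^h − 1) / (r − 1) · H_r.
--
-- Both remainders tend to 0: iterating the one-step equation gives the Markov-type bound
-- r! j #unfinished (j + m) ≤ r^j Σ_{|w| = m} Ψ w, and applying it from time 0 and from time
-- ⌊n/2⌋ bounds ⌊n/2⌋ times either remainder by a constant multiple of r^n.

module Submission where

open import Defs
open import Function using (_∘_; _⇔_; mk⇔; Equivalence)
open import Data.Empty using (⊥-elim)
open import Data.Product using (_×_; _,_; proj₁; proj₂)
open import Data.Nat as ℕ
  using ( ℕ; zero; suc; pred; _+_; _*_; _∸_; _^_; _!; _/_; _≤_; _<_; z≤n; s≤s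
        ; NonZero; ≢-nonZero⁻¹; >-nonZero⁻¹; ⌊_/2⌋; ⌈_/2⌉)
open import Data.Nat.Properties
open import Data.Nat.DivMod using (m*[n/m]≡n)
open import Data.Nat.Coprimality using (Coprime)
open import Data.Nat.Divisibility using (∣-trans; m∣m*n; m≤n⇒m!∣n!)
open import Data.Nat.ListAction using () renaming (sum to sumˡ)
open import Data.Nat.ListAction.Properties using () renaming (sum-++ to sumˡ-++)
open import Data.Nat.Tactic.RingSolver using (solve-∀)
open import Data.Fin as Fin using (Fin)
open import Data.Fin.Properties using (punchInᵢ≢i) renaming (_≟_ to _≟ᶠ_)
open import Data.Vec.Functional using (removeAt)
open import Algebra.Properties.Semiring.Sum +-*-semiring
  using (sum; sum-syntax; sum-cong-≗; sum-remove; ∑-distrib-+; ∑-comm; *-distribˡ-sum; *-distribʳ-sum)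
open import Data.List as List
  using (List; []; _∷_; _∷ʳ_; [_]; length; map; filter; concatMap; tabulate; allFin; take; drop)
open import Data.List.Properties
  using (map-++; map-cong; map-tabulate; take++drop≡id; take-all; length-++; length-replicate)
open import Data.List.Relation.Unary.All as All using (All)
open import Data.List.Relation.Unary.All.Properties using (applyUpTo⁺₁; applyUpTo⁻; tabulate⁻; tabulate⁺)
open import Data.List.Relation.Binary.Prefix.Heterogeneous using (Prefix; []; _∷_)
open import Data.List.Relation.Binary.Infix.Heterogeneous using (here; there; _ⁱ++_)
open import Data.List.Relation.Binary.Infix.Heterogeneous.Properties
  using (∷⁻) renaming (length-mono to Infix-length-mono)
open import Data.Sum using (_⊎_; inj₁; inj₂)
import Data.Integer as ℤ
import Data.Integer.Properties as ℤ
open import Data.Rational as ℚ using (ℚ; mkℚ; 0ℚ; 1ℚ; fromℚᵘ; ∣_∣)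
  renaming (_+_ to _+ℚ_; _*_ to _*ℚ_; _-_ to _-ℚ_; -_ to -ℚ_; _/_ to _/ℚ_; _<_ to _<ℚ_; _≤_ to _≤ℚ_)
import Data.Rational.Properties as ℚ
open import Data.Rational.Solver using (module +-*-Solver)
open import Data.Rational.Unnormalised as ℚᵘ using (mkℚᵘ; *≡*; *<*)
import Data.Rational.Unnormalised.Properties as ℚᵘ
open import Relation.Binary.PropositionalEquality hiding ([_])
open import Relation.Nullary using (Dec; yes; no; ¬_)
open import Relation.Nullary.Decidable using (¬?)

-- Indicators and finite sums

𝟙 : ∀ {p} {P : Set p} → Dec P → ℕ
𝟙 (yes _) = 1
𝟙 (no _)  = 0

𝟙-yes : ∀ {p} {P : Set p} → P → (P? : Dec P) → 𝟙 P? ≡ 1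
𝟙-yes _ (yes _) = refl
𝟙-yes p (no ¬p) = ⊥-elim (¬p p)

𝟙-no : ∀ {p} {P : Set p} → ¬ P → (P? : Dec P) → 𝟙 P? ≡ 0
𝟙-no ¬p (yes p) = ⊥-elim (¬p p)
𝟙-no _  (no _)  = refl

𝟙-¬?+𝟙 : ∀ {p} {P : Set p} (P? : Dec P) → 𝟙 (¬? P?) + 𝟙 P? ≡ 1
𝟙-¬?+𝟙 (yes _) = refl
𝟙-¬?+𝟙 (no _)  = refl

𝟙-cong : ∀ {p q} {P : Set p} {Q : Set q} → (P → Q) → (Q → P) → (P? : Dec P) (Q? : Dec Q) → 𝟙 P? ≡ 𝟙 Q?
𝟙-cong P⇒Q Q⇒P (yes p) Q? = sym (𝟙-yes (P⇒Q p) Q?)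
𝟙-cong P⇒Q Q⇒P (no ¬p) Q? = sym (𝟙-no (¬p ∘ Q⇒P) Q?)

𝟙-firstEntry : ∀ {A B S : Set} (A? : Dec A) (B? : Dec B) (S? : Dec S) →
               (A → B) → S ⇔ (¬ A × B) → 𝟙 S? + 𝟙 (¬? B?) ≡ 𝟙 (¬? A?)
𝟙-firstEntry (yes a) (yes _) S? _   S⇔ = cong (_+ 0) (𝟙-no (λ s → proj₁ (Equivalence.to S⇔ s) a) S?)
𝟙-firstEntry (yes a) (no ¬b) S? A⇒B S⇔ = ⊥-elim (¬b (A⇒B a))
𝟙-firstEntry (no ¬a) (yes b) S? _   S⇔ = cong (_+ 0) (𝟙-yes (Equivalence.from S⇔ (¬a , b)) S?)
𝟙-firstEntry (no ¬a) (no ¬b) S? _   S⇔ = cong (_+ 1) (𝟙-no (λ s → ¬b (proj₂ (Equivalence.to S⇔ s))) S?)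

∑-const : ∀ n c → ∑[ i < n ] c ≡ n * c
∑-const zero    c = refl
∑-const (suc n) c = cong (c +_) (∑-const n c)

∑-mono : ∀ {n} {f g : Fin n → ℕ} → (∀ i → f i ≤ g i) → ∑[ i < n ] f i ≤ ∑[ i < n ] g i
∑-mono {zero}  _   = z≤n
∑-mono {suc n} f≤g = +-mono-≤ (f≤g Fin.zero) (∑-mono (f≤g ∘ Fin.suc))

≤-∑ : ∀ {n} (f : Fin n → ℕ) i → f i ≤ ∑[ j < n ] f j
≤-∑ {suc n} f i = ≤-trans (m≤m+n (f i) _) (≤-reflexive (sym (sum-remove {i = i} f)))

∑-update : ∀ {n} (f g : Fin n → ℕ) i → (∀ j → j ≢ i → f j ≡ g j) →
           ∑[ j < n ] f j + g i ≡ ∑[ j < n ] g j + f i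
∑-update {suc n} f g i f≡g = begin
  sum f + g i                          ≡⟨ cong (_+ g i) (sum-remove {i = i} f) ⟩
  f i + sum (removeAt f i) + g i       ≡⟨ cong (λ s → f i + s + g i) rest ⟩
  f i + sum (removeAt g i) + g i       ≡⟨ swap (f i) (sum (removeAt g i)) (g i) ⟩
  g i + sum (removeAt g i) + f i       ≡⟨ cong (_+ f i) (sum-remove {i = i} g) ⟨
  sum g + f i                          ∎
  where
  open ≡-Reasoning
  rest : sum (removeAt f i) ≡ sum (removeAt g i)
  rest = sum-cong-≗ (λ j → f≡g (Fin.punchIn i j) (punchInᵢ≢i i j))
  swap : ∀ a s b → a + s + b ≡ b + s + a
  swap = solve-∀

≤-stepwise : ∀ (f : ℕ → ℕ) → (∀ n → f n ≤ f (suc n)) → ∀ {m n} → m ≤ n → f m ≤ f n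
≤-stepwise f step {n = zero}  z≤n = ≤-refl
≤-stepwise f step {n = suc n} m≤1+n with m≤n⇒m<n∨m≡n m≤1+n
... | inj₁ (s≤s m≤n) = ≤-trans (≤-stepwise f step m≤n) (step n)
... | inj₂ refl      = ≤-refl

take-++ˡ : ∀ {a} {A : Set a} k (xs ys : List A) → k ≤ length xs → take k (xs List.++ ys) ≡ take k xs
take-++ˡ zero    xs       ys _         = refl
take-++ˡ (suc k) (x ∷ xs) ys (s≤s k≤n) = cong (x ∷_) (take-++ˡ k xs ys k≤n)

sumˡ-tabulate : ∀ {n} (g : Fin n → ℕ) → sumˡ (tabulate g) ≡ ∑[ i < n ] g i
sumˡ-tabulate {zero}  g = refl
sumˡ-tabulate {suc n} g = cong (g Fin.zero +_) (sumˡ-tabulate (g ∘ Fin.suc))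

length-filter : ∀ {a p} {A : Set a} {P : A → Set p} (P? : ∀ x → Dec (P x)) xs →
                length (filter P? xs) ≡ sumˡ (map (𝟙 ∘ P?) xs)
length-filter P? []       = refl
length-filter P? (x ∷ xs) with P? x
... | yes _ = cong suc (length-filter P? xs)
... | no _  = length-filter P? xs

sumˡ-map-concatMap : ∀ {a b} {A : Set a} {B : Set b} (f : B → ℕ) (g : A → List B) xs →
                     sumˡ (map f (concatMap g xs)) ≡ sumˡ (map (λ x → sumˡ (map f (g x))) xs)
sumˡ-map-concatMap f g []       = refl
sumˡ-map-concatMap f g (x ∷ xs) = begin
  sumˡ (map f (g x List.++ concatMap g xs))          ≡⟨ cong sumˡ (map-++ f (g x) _) ⟩
  sumˡ (map f (g x) List.++ map f (concatMap g xs))  ≡⟨ sumˡ-++ (map f (g x)) _ ⟩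
  sumˡ (map f (g x)) + sumˡ (map f (concatMap g xs)) ≡⟨ cong (_ +_) (sumˡ-map-concatMap f g xs) ⟩
  sumˡ (map f (g x)) + sumˡ (map (λ x → sumˡ (map f (g x))) xs) ∎
  where open ≡-Reasoning

-- Sums over all words of a given length

module _ {r : ℕ} where

  ∑words : ℕ → (Word r → ℕ) → ℕ
  ∑words zero    f = f []
  ∑words (suc n) f = ∑words n (λ w → ∑[ a < r ] f (a ∷ w))

  sumˡ-map-words : ∀ n f → sumˡ (map f (words r n)) ≡ ∑words n f
  sumˡ-map-words zero    f = +-identityʳ (f [])
  sumˡ-map-words (suc n) f = begin
    sumˡ (map f (words r (suc n)))
      ≡⟨ sumˡ-map-concatMap f _ (words r n) ⟩
    sumˡ (map (λ w → sumˡ (map f (map (_∷ w) (allFin r)))) (words r n))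
      ≡⟨ cong sumˡ (map-cong letters (words r n)) ⟩
    sumˡ (map (λ w → ∑[ a < r ] f (a ∷ w)) (words r n))
      ≡⟨ sumˡ-map-words n _ ⟩
    ∑words (suc n) f ∎
    where
    open ≡-Reasoning
    letters : ∀ w → sumˡ (map f (map (_∷ w) (allFin r))) ≡ ∑[ a < r ] f (a ∷ w)
    letters w = begin
      sumˡ (map f (map (_∷ w) (allFin r)))   ≡⟨ cong (sumˡ ∘ map f) (map-tabulate (λ a → a) (_∷ w)) ⟩
      sumˡ (map f (tabulate (_∷ w)))         ≡⟨ cong sumˡ (map-tabulate (_∷ w) f) ⟩
      sumˡ (tabulate (λ a → f (a ∷ w)))      ≡⟨ sumˡ-tabulate {n = r} _ ⟩
      ∑[ a < r ] f (a ∷ w)                   ∎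

  length-filter-words : ∀ {p} {P : Word r → Set p} (P? : ∀ w → Dec (P w)) n →
                        length (filter P? (words r n)) ≡ ∑words n (𝟙 ∘ P?)
  length-filter-words P? n = trans (length-filter P? (words r n)) (sumˡ-map-words n _)

  ∑words-cong : ∀ n {f g : Word r → ℕ} → (∀ w → length w ≡ n → f w ≡ g w) →
                ∑words n f ≡ ∑words n g
  ∑words-cong zero    f≡g = f≡g [] refl
  ∑words-cong (suc n) f≡g = ∑words-cong n λ w |w| → sum-cong-≗ {n = r} λ a → f≡g (a ∷ w) (cong suc |w|)

  ∑words-mono : ∀ n {f g : Word r → ℕ} → (∀ w → length w ≡ n → f w ≤ g w) →
                ∑words n f ≤ ∑words n g
  ∑words-mono zero    f≤g = f≤g [] refl
  ∑words-mono (suc n) f≤g = ∑words-mono n λ w |w| → ∑-mono λ a → f≤g (a ∷ w) (cong suc |w|)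

  ∑words-+ : ∀ n (f g : Word r → ℕ) → ∑words n (λ w → f w + g w) ≡ ∑words n f + ∑words n g
  ∑words-+ zero    f g = refl
  ∑words-+ (suc n) f g = trans (∑words-cong n (λ w _ → ∑-distrib-+ {n = r} _ _)) (∑words-+ n _ _)

  ∑words-*ˡ : ∀ n c (f : Word r → ℕ) → ∑words n (λ w → c * f w) ≡ c * ∑words n f
  ∑words-*ˡ zero    c f = refl
  ∑words-*ˡ (suc n) c f = trans (∑words-cong n (λ w _ → sym (*-distribˡ-sum {n = r} c _))) (∑words-*ˡ n c _)

  ∑words-∷ʳ : ∀ n (f : Word r → ℕ) → ∑words (suc n) f ≡ ∑words n (λ v → ∑[ a < r ] f (v ∷ʳ a))
  ∑words-∷ʳ zero    f = refl
  ∑words-∷ʳ (suc n) f = trans (∑words-∷ʳ n (λ w → ∑[ a < r ] f (a ∷ w)))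
                              (∑words-cong n (λ v _ → ∑-comm {m = r} {n = r} (λ b a → f (a ∷ v ∷ʳ b))))

-- Runs

module _ {r h : ℕ} where

  HasRun-take : ∀ {b : Fin r} k v → HasRun h b (take k v) → HasRun h b v
  HasRun-take k v run = subst (HasRun h _) (take++drop≡id k v) (run ⁱ++ drop k v)

  AllRuns-take : ∀ k (v : Word r) → AllRuns r h (take k v) → AllRuns r h v
  AllRuns-take k v = All.map (HasRun-take k v)

  AllRuns-∷ʳ : ∀ (v : Word r) a → AllRuns r h v → AllRuns r h (v ∷ʳ a)
  AllRuns-∷ʳ v a = All.map (_ⁱ++ [ a ])

  AllRuns-∷ : ∀ a (v : Word r) → AllRuns r h v → AllRuns r h (a ∷ v)
  AllRuns-∷ a v = All.map there

  ¬HasRun-[] : ∀ {b : Fin r} → 1 ≤ h → ¬ HasRun h b []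
  ¬HasRun-[] {b} 1≤h run = <⇒≱ 1≤h (begin
    h                             ≡⟨ length-replicate h ⟨
    length (List.replicate h b)   ≤⟨ Infix-length-mono run ⟩
    0                             ∎)
    where open ≤-Reasoning

  ¬AllRuns-[] : 1 ≤ r → 1 ≤ h → ¬ AllRuns r h []
  ¬AllRuns-[] 1≤r 1≤h runs = ¬HasRun-[] 1≤h (tabulate⁻ runs (Fin.fromℕ< 1≤r))

module _ {r : ℕ} where

  leadingRun : Fin r → Word r → ℕ
  leadingRun b []      = 0
  leadingRun b (a ∷ w) with a ≟ᶠ b
  ... | yes _ = suc (leadingRun b w)
  ... | no _  = 0

  leadingRun-≡ : ∀ b w → leadingRun b (b ∷ w) ≡ suc (leadingRun b w)
  leadingRun-≡ b w with b ≟ᶠ b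
  ... | yes _ = refl
  ... | no b≢b = ⊥-elim (b≢b refl)

  leadingRun-≢ : ∀ {a b} w → a ≢ b → leadingRun b (a ∷ w) ≡ 0
  leadingRun-≢ {a} {b} w a≢b with a ≟ᶠ b
  ... | yes a≡b = ⊥-elim (a≢b a≡b)
  ... | no _    = refl

  Prefix-replicate⇒≤leadingRun : ∀ n b w → Prefix _≡_ (List.replicate n b) w → n ≤ leadingRun b w
  Prefix-replicate⇒≤leadingRun zero    b w       _            = z≤n
  Prefix-replicate⇒≤leadingRun (suc n) b (a ∷ w) (refl ∷ pre) =
    ≤-trans (s≤s (Prefix-replicate⇒≤leadingRun n b w pre)) (≤-reflexive (sym (leadingRun-≡ b w)))

  ≤leadingRun⇒Prefix-replicate : ∀ n b w → n ≤ leadingRun b w → Prefix _≡_ (List.replicate n b) w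
  ≤leadingRun⇒Prefix-replicate zero    b w       _ = []
  ≤leadingRun⇒Prefix-replicate (suc n) b (a ∷ w) n<run with a ≟ᶠ b
  ≤leadingRun⇒Prefix-replicate (suc n) b (a ∷ w) (s≤s n≤run) | yes refl =
    refl ∷ ≤leadingRun⇒Prefix-replicate n b w n≤run

  module _ {h : ℕ} where

    leadingRun<h : ∀ {b} w → ¬ HasRun h b w → leadingRun b w < h
    leadingRun<h w ¬run = ≰⇒> (λ h≤run → ¬run (here (≤leadingRun⇒Prefix-replicate h _ w h≤run)))

    HasRun-∷⁻ : ∀ {a b} w → HasRun h b (a ∷ w) → h ≤ leadingRun b (a ∷ w) ⊎ HasRun h b w
    HasRun-∷⁻ w run with ∷⁻ run
    ... | inj₁ pre = inj₁ (Prefix-replicate⇒≤leadingRun h _ (_ ∷ w) pre)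
    ... | inj₂ run′ = inj₂ run′

    HasRun-∷-≢ : .{{_ : NonZero h}} → ∀ {a b} w → a ≢ b → HasRun h b (a ∷ w) → HasRun h b w
    HasRun-∷-≢ w a≢b run with HasRun-∷⁻ w run
    ... | inj₁ h≤run = ⊥-elim (≢-nonZero⁻¹ h (n≤0⇒n≡0 (subst (h ≤_) (leadingRun-≢ w a≢b) h≤run)))
    ... | inj₂ run′  = run′

-- The distribution of the stopping time

module _ {r h : ℕ} where

  stopsAt-∷ʳ⇔ : ∀ {m} (v : Word r) a → length v ≡ m →
                StopsAt r h (suc m) (v ∷ʳ a) ⇔ (¬ AllRuns r h v × AllRuns r h (v ∷ʳ a))
  stopsAt-∷ʳ⇔ {m} v a refl = mk⇔ to from
    where
    take-v∷ʳa : ∀ {k} → k ≤ length v → take k (v ∷ʳ a) ≡ take k v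
    take-v∷ʳa {k} = take-++ˡ k v [ a ]

    v∷ʳa≤ : length (v ∷ʳ a) ≤ suc m
    v∷ʳa≤ = ≤-reflexive (trans (length-++ v) (+-comm m 1))

    to : StopsAt r h (suc m) (v ∷ʳ a) → ¬ AllRuns r h v × AllRuns r h (v ∷ʳ a)
    to (runs , early) = notYet , AllRuns-take (suc m) (v ∷ʳ a) runs
      where
      notYet : ¬ AllRuns r h v
      notYet runsᵥ = applyUpTo⁻ (λ k → k) (suc m) early ≤-refl
        (subst (AllRuns r h) (sym (trans (take-v∷ʳa ≤-refl) (take-all m v ≤-refl))) runsᵥ)

    from : ¬ AllRuns r h v × AllRuns r h (v ∷ʳ a) → StopsAt r h (suc m) (v ∷ʳ a)
    from (notYet , runs) = subst (AllRuns r h) (sym (take-all (suc m) (v ∷ʳ a) v∷ʳa≤)) runs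
                         , applyUpTo⁺₁ (λ k → k) (suc m) early
      where
      early : ∀ {k} → k < suc m → ¬ AllRuns r h (take k (v ∷ʳ a))
      early (s≤s k≤m) runsₖ = notYet (AllRuns-take _ v (subst (AllRuns r h) (take-v∷ʳa k≤m) runsₖ))

module Unfinished (r h : ℕ) where

  unfinished : Word r → ℕ
  unfinished w = 𝟙 (¬? (allRuns? r h w))

  -- r ^ n · P{B > n}
  #unfinished : ℕ → ℕ
  #unfinished n = ∑words n unfinished

  stop+unfinished : ∀ {m} (v : Word r) a → length v ≡ m →
                    𝟙 (stopsAt? r h (suc m) (v ∷ʳ a)) + unfinished (v ∷ʳ a) ≡ unfinished v
  stop+unfinished v a |v| = 𝟙-firstEntry (allRuns? r h v) (allRuns? r h (v ∷ʳ a)) (stopsAt? r h _ (v ∷ʳ a))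
                                         (AllRuns-∷ʳ v a) (stopsAt-∷ʳ⇔ v a |v|)

  countStops-suc : ∀ m → countStops r h (suc m) + #unfinished (suc m) ≡ r * #unfinished m
  countStops-suc m = begin
    countStops r h (suc m) + #unfinished (suc m)
      ≡⟨ cong (_+ #unfinished (suc m)) (length-filter-words (stopsAt? r h (suc m)) (suc m)) ⟩
    ∑words (suc m) stop + ∑words (suc m) unfinished
      ≡⟨ cong₂ _+_ (∑words-∷ʳ m stop) (∑words-∷ʳ m unfinished) ⟩
    ∑words m (λ v → ∑[ a < r ] stop (v ∷ʳ a)) + ∑words m (λ v → ∑[ a < r ] unfinished (v ∷ʳ a))
      ≡⟨ ∑words-+ m _ _ ⟨
    ∑words m (λ v → ∑[ a < r ] stop (v ∷ʳ a) + ∑[ a < r ] unfinished (v ∷ʳ a))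
      ≡⟨ ∑words-cong m (λ v |v| → trans (sym (∑-distrib-+ {n = r} _ _))
                                         (sum-cong-≗ {n = r} (λ a → stop+unfinished v a |v|))) ⟩
    ∑words m (λ v → ∑[ a < r ] unfinished v)
      ≡⟨ ∑words-cong m (λ v _ → ∑-const r (unfinished v)) ⟩
    ∑words m (λ v → r * unfinished v)
      ≡⟨ ∑words-*ˡ m r unfinished ⟩
    r * #unfinished m ∎
    where
    open ≡-Reasoning
    stop : Word r → ℕ
    stop = 𝟙 ∘ stopsAt? r h (suc m)

  #unfinished-suc : ∀ m → #unfinished (suc m) ≤ r * #unfinished m
  #unfinished-suc m = ≤-trans (m≤n+m _ _) (≤-reflexive (countStops-suc m))

  module _ (1≤r : 1 ≤ r) (1≤h : 1 ≤ h) where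

    countStops-0 : countStops r h 0 ≡ 0
    countStops-0 = trans (length-filter-words (stopsAt? r h 0) 0)
                         (𝟙-no (¬AllRuns-[] 1≤r 1≤h ∘ proj₁) (stopsAt? r h 0 []))

    #unfinished-0 : #unfinished 0 ≡ 1
    #unfinished-0 = 𝟙-yes (¬AllRuns-[] 1≤r 1≤h) (¬? (allRuns? r h []))

-- The potential

-- The arithmetic of Ψ-step-unfinished: u of the r letters are missing and d are done, c = L / u.
potential-step : ∀ {r L R₀ R₁ Rκ Rκ⁺ u d c H S} →
  u * c ≡ L → R₀ ≡ r + R₁ → u + d ≡ r → r * Rκ + R₁ ≡ Rκ⁺ + r * R₀ →
  S + R₁ ≡ d * R₀ + u * R₁ + Rκ⁺ →
  r * (R₀ * H + Rκ * c) ≡ r * L + (r * (R₀ * H) + S * c)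
potential-step {R₁ = R₁} {Rκ} {Rκ⁺} {u} {d} {c} {H} {S} refl refl refl run∑ after∑ =
  +-cancelʳ-≡ (R₁ * c) _ _ (begin
    r * (R₀ * H + Rκ * c) + R₁ * c
      ≡⟨ e₁ u d R₁ Rκ c H ⟩
    r * (R₀ * H) + (r * Rκ + R₁) * c
      ≡⟨ cong (λ x → r * (R₀ * H) + x * c) run∑ ⟩
    r * (R₀ * H) + (Rκ⁺ + r * R₀) * c
      ≡⟨ e₂ u d R₁ Rκ⁺ c H ⟩
    r * (u * c) + r * (R₀ * H) + (d * R₀ + u * R₁ + Rκ⁺) * c
      ≡⟨ cong (λ x → r * (u * c) + r * (R₀ * H) + x * c) after∑ ⟨
    r * (u * c) + r * (R₀ * H) + (S + R₁) * c
      ≡⟨ e₃ (r * (u * c)) (r * (R₀ * H)) S R₁ c ⟩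
    r * (u * c) + (r * (R₀ * H) + S * c) + R₁ * c ∎)
  where
  open ≡-Reasoning
  r = u + d
  R₀ = r + R₁
  e₁ : ∀ u d R₁ Rκ c H → (u + d) * ((u + d + R₁) * H + Rκ * c) + R₁ * c
                       ≡ (u + d) * ((u + d + R₁) * H) + ((u + d) * Rκ + R₁) * c
  e₁ = solve-∀
  e₂ : ∀ u d R₁ Rκ⁺ c H → (u + d) * ((u + d + R₁) * H) + (Rκ⁺ + (u + d) * (u + d + R₁)) * c
                        ≡ (u + d) * (u * c) + (u + d) * ((u + d + R₁) * H)
                          + (d * (u + d + R₁) + u * R₁ + Rκ⁺) * c
  e₂ = solve-∀
  e₃ : ∀ a b S R₁ c → a + b + (S + R₁) * c ≡ a + (b + S * c) + R₁ * c
  e₃ = solve-∀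

module Potential (r h : ℕ) .{{_ : NonZero r}} .{{_ : NonZero h}} where

  open Unfinished r h

  -- inv u = r!/u and harm u = r! · (1 + 1/2 + ⋯ + 1/u): reciprocals and harmonic numbers
  -- scaled by r! so that everything stays in ℕ.
  inv : ℕ → ℕ
  inv zero    = 0
  inv (suc u) = r ! / suc u

  harm : ℕ → ℕ
  harm zero    = 0
  harm (suc u) = harm u + inv (suc u)

  *-inv : ∀ {u} → 1 ≤ u → u ≤ r → u * inv u ≡ r !
  *-inv {suc u} _ u<r = m*[n/m]≡n (∣-trans (m∣m*n (u !)) (m≤n⇒m!∣n! u<r))

  harm-pred : ∀ u → harm (pred u) + inv u ≡ harm u
  harm-pred zero    = refl
  harm-pred (suc u) = refl

  harm-mono : ∀ {m n} → m ≤ n → harm m ≤ harm n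
  harm-mono = ≤-stepwise harm (λ n → m≤m+n (harm n) _)

  geom : ℕ → ℕ
  geom zero    = 0
  geom (suc d) = r * suc (geom d)

  geom-mono : ∀ {m n} → m ≤ n → geom m ≤ geom n
  geom-mono = ≤-stepwise geom (λ d → ≤-trans (n≤1+n (geom d)) (m≤n*m (suc (geom d)) r))

  geom*[r∸1] : ∀ d → geom d * (r ∸ 1) + r ≡ r * r ^ d
  geom*[r∸1] zero    = sym (*-identityʳ r)
  geom*[r∸1] (suc d) = begin
    r * suc (geom d) * (r ∸ 1) + r
      ≡⟨ rearrange r (geom d) (r ∸ 1) ⟩
    r * (geom d * (r ∸ 1) + suc (r ∸ 1))
      ≡⟨ cong (λ s → r * (geom d * (r ∸ 1) + s)) (m+[n∸m]≡n (>-nonZero⁻¹ r)) ⟩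
    r * (geom d * (r ∸ 1) + r)
      ≡⟨ cong (r *_) (geom*[r∸1] d) ⟩
    r * (r * r ^ d) ∎
    where
    open ≡-Reasoning
    rearrange : ∀ r g s → r * suc g * s + r ≡ r * (g * s + suc s)
    rearrange = solve-∀

  -- R k = r^(k+1) + ⋯ + r^h is the expected number of further letters needed to extend
  -- a run of length k of a given letter to a run of length h.
  R : ℕ → ℕ
  R k = geom h ∸ geom k

  R₀ : ℕ
  R₀ = R 0

  R₀*[r∸1] : R₀ * (r ∸ 1) ≡ r * (r ^ h ∸ 1)
  R₀*[r∸1] = sym (begin
    r * (r ^ h ∸ 1)               ≡⟨ *-distribˡ-∸ r (r ^ h) 1 ⟩
    r * r ^ h ∸ r * 1             ≡⟨ cong₂ _∸_ (sym (geom*[r∸1] h)) (*-identityʳ r) ⟩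
    geom h * (r ∸ 1) + r ∸ r      ≡⟨ m+n∸n≡m _ r ⟩
    R₀ * (r ∸ 1)                  ∎)
    where open ≡-Reasoning

  geom+R : ∀ {k} → k ≤ h → geom k + R k ≡ geom h
  geom+R k≤h = m+[n∸m]≡n (geom-mono k≤h)

  R-h : R h ≡ 0
  R-h = n∸n≡0 (geom h)

  R≤R₀ : ∀ k → R k ≤ R₀
  R≤R₀ k = m∸n≤m (geom h) (geom k)

  1≤h : 1 ≤ h
  1≤h = >-nonZero⁻¹ h

  R₀≡r+R₁ : R₀ ≡ r + R 1
  R₀≡r+R₁ = sym (trans (cong (_+ R 1) (sym (*-identityʳ r))) (geom+R 1≤h))

  -- Both sides exceed r · geom h + geom h by r · geom k + r.
  R-suc : ∀ {k} → k < h → r * R k + R 1 ≡ R (suc k) + r * R₀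
  R-suc {k} k<h = +-cancelʳ-≡ (r * geom k + r) _ _ (begin
    r * R k + R 1 + (r * geom k + r)            ≡⟨ regroupˡ r (R k) (R 1) (geom k) ⟩
    r * (geom k + R k) + (geom 1 + R 1)          ≡⟨ cong₂ (λ x y → r * x + y) (geom+R (<⇒≤ k<h)) (geom+R 1≤h) ⟩
    r * geom h + geom h                          ≡⟨ +-comm (r * geom h) (geom h) ⟩
    geom h + r * geom h                          ≡⟨ cong (_+ r * geom h) (geom+R k<h) ⟨
    geom (suc k) + R (suc k) + r * geom h        ≡⟨ regroupʳ r (R (suc k)) (geom h) (geom k) ⟩
    R (suc k) + r * R₀ + (r * geom k + r)        ∎)
    where
    open ≡-Reasoning
    regroupˡ : ∀ r x y g → r * x + y + (r * g + r) ≡ r * (g + x) + (r * 1 + y)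
    regroupˡ = solve-∀
    regroupʳ : ∀ r x G g → r * suc g + x + r * G ≡ x + r * G + (r * g + r)
    regroupʳ = solve-∀

  missing : Fin r → Word r → ℕ
  missing b w = 𝟙 (¬? (hasRun? h b w))

  done : Fin r → Word r → ℕ
  done b w = 𝟙 (hasRun? h b w)

  #missing : Word r → ℕ
  #missing w = ∑[ b < r ] missing b w

  #done : Word r → ℕ
  #done w = ∑[ b < r ] done b w

  missing≡0 : ∀ {b w} → HasRun h b w → missing b w ≡ 0
  missing≡0 run = 𝟙-no (λ ¬run → ¬run run) _

  missing≡1 : ∀ {b w} → ¬ HasRun h b w → missing b w ≡ 1
  missing≡1 ¬run = 𝟙-yes ¬run _

  #missing+#done : ∀ w → #missing w + #done w ≡ r
  #missing+#done w = begin
    #missing w + #done w                   ≡⟨ ∑-distrib-+ {n = r} _ _ ⟨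
    ∑[ b < r ] (missing b w + done b w)    ≡⟨ sum-cong-≗ {n = r} (λ b → 𝟙-¬?+𝟙 (hasRun? h b w)) ⟩
    ∑[ b < r ] 1                           ≡⟨ ∑-const r 1 ⟩
    r * 1                                  ≡⟨ *-identityʳ r ⟩
    r                                      ∎
    where open ≡-Reasoning

  #missing≤r : ∀ w → #missing w ≤ r
  #missing≤r w = ≤-trans (m≤m+n _ (#done w)) (≤-reflexive (#missing+#done w))

  #missing-∷ : ∀ b w → #missing (b ∷ w) + missing b w ≡ #missing w + missing b (b ∷ w)
  #missing-∷ b w = ∑-update (λ x → missing x (b ∷ w)) (λ x → missing x w) b λ x x≢b →
    𝟙-cong (λ ¬run run → ¬run (there run)) (λ ¬run run → ¬run (HasRun-∷-≢ w (x≢b ∘ sym) run)) _ _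

  #missing≡0⇒AllRuns : ∀ w → #missing w ≡ 0 → AllRuns r h w
  #missing≡0⇒AllRuns w none = tabulate⁺ decide
    where
    decide : ∀ b → HasRun h b w
    decide b with hasRun? h b w
    ... | yes run = run
    ... | no ¬run = ⊥-elim (1+n≰n (begin
      1            ≡⟨ missing≡1 ¬run ⟨
      missing b w  ≤⟨ ≤-∑ (λ b → missing b w) b ⟩
      #missing w   ≡⟨ none ⟩
      0            ∎))
      where open ≤-Reasoning

  AllRuns⇒#missing≡0 : ∀ w → AllRuns r h w → #missing w ≡ 0
  AllRuns⇒#missing≡0 w runs = begin
    #missing w     ≡⟨ sum-cong-≗ {n = r} (λ b → missing≡0 (tabulate⁻ runs b)) ⟩
    ∑[ b < r ] 0   ≡⟨ ∑-const r 0 ⟩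
    r * 0          ≡⟨ *-zeroʳ r ⟩
    0              ∎
    where open ≡-Reasoning

  pendingRun : Word r → ℕ
  pendingRun []      = 0
  pendingRun (a ∷ w) = missing a (a ∷ w) * leadingRun a (a ∷ w)

  pendingRun<h : ∀ w → pendingRun w < h
  pendingRun<h []      = 1≤h
  pendingRun<h (a ∷ w) with hasRun? h a (a ∷ w)
  ... | yes _    = 1≤h
  ... | no ¬run  = subst (_< h) (sym (*-identityˡ _)) (leadingRun<h (a ∷ w) ¬run)

  -- r! times the expected number of letters still to be read when u letters lack an h-run and
  -- the newest letter is one of them with a current run of length k (k = 0 otherwise):
  -- r! · (R₀ H_{u-1} + R_k / u).  The newest letter is the head of the word; as all sums below
  -- range over all words of a given length, this reversal of the reading order is harmless.
  potential : ℕ → ℕ → ℕ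
  potential u k = R₀ * harm (pred u) + R k * inv u

  Ψ : Word r → ℕ
  Ψ w = potential (#missing w) (pendingRun w)

  Ψ₀ : ℕ
  Ψ₀ = R₀ * harm r

  potential-0 : ∀ u → potential u 0 ≡ R₀ * harm u
  potential-0 u = trans (sym (*-distribˡ-+ R₀ _ _)) (cong (R₀ *_) (harm-pred u))

  potential-h : ∀ u → potential (suc u) h ≡ potential u 0
  potential-h u = begin
    R₀ * harm u + R h * inv (suc u) ≡⟨ cong (λ x → R₀ * harm u + x * inv (suc u)) R-h ⟩
    R₀ * harm u + 0                 ≡⟨ +-identityʳ _ ⟩
    R₀ * harm u                     ≡⟨ potential-0 u ⟨
    potential u 0                   ∎
    where open ≡-Reasoning

  -- The index of R once b is read: the new run of b if b still lacked an h-run, else 0.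
  afterRun : Fin r → Word r → ℕ
  afterRun b w = missing b w * suc (leadingRun b w)

  Ψ-∷ : ∀ b w → Ψ (b ∷ w) ≡ potential (#missing w) (afterRun b w)
  Ψ-∷ b w with hasRun? h b w | hasRun? h b (b ∷ w) | #missing-∷ b w
  ... | yes _   | yes _    | M′+0≡M+0 = cong (λ u → potential u 0) (+-cancelʳ-≡ 0 _ _ M′+0≡M+0)
  ... | yes run | no ¬run′ | _        = ⊥-elim (¬run′ (there run))
  ... | no ¬run | no _     | M′+1≡M+1 =
    cong₂ (λ u k → potential u (1 * k)) (+-cancelʳ-≡ 1 _ _ M′+1≡M+1) (leadingRun-≡ b w)
  ... | no ¬run | yes run′ | M′+1≡M+0 = begin
    potential M′ 0                          ≡⟨ potential-h M′ ⟨
    potential (suc M′) h                    ≡⟨ cong₂ potential M≡1+M′ completed ⟨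
    potential (#missing w) (1 * suc (leadingRun b w)) ∎
    where
    open ≡-Reasoning
    M′ = #missing (b ∷ w)
    M≡1+M′ : #missing w ≡ suc M′
    M≡1+M′ = trans (sym (+-identityʳ _)) (trans (sym M′+1≡M+0) (+-comm M′ 1))
    h≤run : h ≤ suc (leadingRun b w)
    h≤run with HasRun-∷⁻ w run′
    ... | inj₁ h≤ = subst (h ≤_) (leadingRun-≡ b w) h≤
    ... | inj₂ run = ⊥-elim (¬run run)
    completed : 1 * suc (leadingRun b w) ≡ h
    completed = trans (*-identityˡ _) (≤-antisym (leadingRun<h w ¬run) h≤run)

  freshCost : Fin r → Word r → ℕ
  freshCost b w = done b w * R₀ + missing b w * R 1

  R-afterRun : ∀ b w → R (afterRun b w) + R 1 ≡ freshCost b w + R (suc (missing b w * leadingRun b w))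
  R-afterRun b w with hasRun? h b w
  ... | yes _ = cong (_+ R 1) (sym (trans (+-identityʳ _) (+-identityʳ _)))
  ... | no _  = trans (+-comm _ (R 1)) (cong (_+ R (suc (1 * leadingRun b w))) (sym (+-identityʳ (R 1))))

  R-afterRun-fresh : ∀ b w → leadingRun b w ≡ 0 → R (afterRun b w) ≡ freshCost b w
  R-afterRun-fresh b w run≡0 = +-cancelʳ-≡ (R 1) _ _ (begin
    R (afterRun b w) + R 1
      ≡⟨ R-afterRun b w ⟩
    freshCost b w + R (suc (missing b w * leadingRun b w))
      ≡⟨ cong (λ k → freshCost b w + R (suc (missing b w * k))) run≡0 ⟩
    freshCost b w + R (suc (missing b w * 0))
      ≡⟨ cong (λ k → freshCost b w + R (suc k)) (*-zeroʳ (missing b w)) ⟩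
    freshCost b w + R 1 ∎)
    where open ≡-Reasoning

  ∑freshCost : ∀ w → ∑[ b < r ] freshCost b w ≡ #done w * R₀ + #missing w * R 1
  ∑freshCost w = trans (∑-distrib-+ {n = r} _ _)
    (cong₂ _+_ (sym (*-distribʳ-sum R₀ (λ b → done b w))) (sym (*-distribʳ-sum (R 1) (λ b → missing b w))))

  -- Only the newest letter can carry a run, so all other letters cost their fresh price.
  ∑R-afterRun : ∀ w → ∑[ b < r ] R (afterRun b w) + R 1
                    ≡ #done w * R₀ + #missing w * R 1 + R (suc (pendingRun w))
  ∑R-afterRun [] = cong (_+ R 1) (trans (sum-cong-≗ {n = r} (λ b → R-afterRun-fresh b [] refl)) (∑freshCost []))
  ∑R-afterRun w@(a ∷ v) = +-cancelʳ-≡ (g a) _ _ (begin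
    ∑[ b < r ] f b + R 1 + g a                      ≡⟨ swap (∑[ b < r ] f b) (R 1) (g a) ⟩
    ∑[ b < r ] f b + g a + R 1                      ≡⟨ cong (_+ R 1) (∑-update f g a fresh) ⟩
    ∑[ b < r ] g b + f a + R 1                      ≡⟨ +-assoc _ (f a) (R 1) ⟩
    ∑[ b < r ] g b + (f a + R 1)                    ≡⟨ cong (∑[ b < r ] g b +_) (R-afterRun a w) ⟩
    ∑[ b < r ] g b + (g a + R (suc (pendingRun w))) ≡⟨ regroup (∑[ b < r ] g b) (g a) _ ⟩
    ∑[ b < r ] g b + R (suc (pendingRun w)) + g a
      ≡⟨ cong (λ s → s + R (suc (pendingRun w)) + g a) (∑freshCost w) ⟩
    #done w * R₀ + #missing w * R 1 + R (suc (pendingRun w)) + g a ∎)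
    where
    open ≡-Reasoning
    f g : Fin r → ℕ
    f b = R (afterRun b w)
    g b = freshCost b w
    fresh : ∀ b → b ≢ a → f b ≡ g b
    fresh b b≢a = R-afterRun-fresh b w (leadingRun-≢ v (b≢a ∘ sym))
    swap : ∀ x y z → x + y + z ≡ x + z + y
    swap = solve-∀
    regroup : ∀ x y z → x + (y + z) ≡ x + z + y
    regroup = solve-∀

  Ψ-finished : ∀ w → AllRuns r h w → Ψ w ≡ 0
  Ψ-finished w runs = trans (cong (λ u → potential u (pendingRun w)) (AllRuns⇒#missing≡0 w runs))
                            (cong₂ _+_ (*-zeroʳ R₀) (*-zeroʳ (R (pendingRun w))))

  Ψ≤Ψ₀ : ∀ w → Ψ w ≤ Ψ₀
  Ψ≤Ψ₀ w = begin
    potential M (pendingRun w) ≤⟨ +-monoʳ-≤ (R₀ * harm (pred M)) (*-monoˡ-≤ (inv M) (R≤R₀ (pendingRun w))) ⟩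
    potential M 0              ≡⟨ potential-0 M ⟩
    R₀ * harm M                ≤⟨ *-monoʳ-≤ R₀ (harm-mono (#missing≤r w)) ⟩
    Ψ₀                         ∎
    where
    open ≤-Reasoning
    M = #missing w

  Ψ-[] : Ψ [] ≡ Ψ₀
  Ψ-[] = trans (cong (λ u → potential u 0) #missing-[]) (potential-0 r)
    where
    #missing-[] : #missing [] ≡ r
    #missing-[] = begin
      #missing []     ≡⟨ sum-cong-≗ {n = r} (λ b → missing≡1 (¬HasRun-[] 1≤h)) ⟩
      ∑[ b < r ] 1    ≡⟨ ∑-const r 1 ⟩
      r * 1           ≡⟨ *-identityʳ r ⟩
      r               ∎
      where open ≡-Reasoning

  Ψ-step-unfinished : ∀ w → ¬ AllRuns r h w → r * Ψ w ≡ r * r ! + ∑[ b < r ] Ψ (b ∷ w)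
  Ψ-step-unfinished w ¬runs = begin
    r * potential M (pendingRun w)
      ≡⟨ potential-step {u = M} {d = #done w} {H = harm (pred M)} {S = ∑[ b < r ] R (afterRun b w)}
                        (*-inv 1≤M (#missing≤r w)) R₀≡r+R₁ (#missing+#done w)
                        (R-suc (pendingRun<h w)) (∑R-afterRun w) ⟩
    r * r ! + (r * (R₀ * harm (pred M)) + ∑[ b < r ] R (afterRun b w) * inv M)
      ≡⟨ cong (r * r ! +_) ∑Ψ-∷ ⟨
    r * r ! + ∑[ b < r ] Ψ (b ∷ w) ∎
    where
    open ≡-Reasoning
    M = #missing w
    1≤M : 1 ≤ M
    1≤M = n≢0⇒n>0 (¬runs ∘ #missing≡0⇒AllRuns w)
    ∑Ψ-∷ : ∑[ b < r ] Ψ (b ∷ w) ≡ r * (R₀ * harm (pred M)) + ∑[ b < r ] R (afterRun b w) * inv M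
    ∑Ψ-∷ = begin
      ∑[ b < r ] Ψ (b ∷ w)
        ≡⟨ sum-cong-≗ {n = r} (λ b → Ψ-∷ b w) ⟩
      ∑[ b < r ] (R₀ * harm (pred M) + R (afterRun b w) * inv M)
        ≡⟨ ∑-distrib-+ {n = r} _ _ ⟩
      ∑[ b < r ] (R₀ * harm (pred M)) + ∑[ b < r ] (R (afterRun b w) * inv M)
        ≡⟨ cong₂ _+_ (∑-const r _) (sym (*-distribʳ-sum (inv M) (λ b → R (afterRun b w)))) ⟩
      r * (R₀ * harm (pred M)) + ∑[ b < r ] R (afterRun b w) * inv M ∎

  Ψ-step : ∀ w → r * Ψ w ≡ r * r ! * unfinished w + ∑[ b < r ] Ψ (b ∷ w)
  Ψ-step w with allRuns? r h w
  ... | no ¬runs = trans (Ψ-step-unfinished w ¬runs)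
                         (cong (_+ ∑[ b < r ] Ψ (b ∷ w)) (sym (*-identityʳ (r * r !))))
  ... | yes runs = begin
    r * Ψ w                                  ≡⟨ cong (r *_) (Ψ-finished w runs) ⟩
    r * 0                                    ≡⟨ *-zeroʳ r ⟩
    0                                        ≡⟨ cong₂ _+_ (*-zeroʳ (r * r !)) ∑Ψ-∷≡0 ⟨
    r * r ! * 0 + ∑[ b < r ] Ψ (b ∷ w)       ∎
    where
    open ≡-Reasoning
    ∑Ψ-∷≡0 : ∑[ b < r ] Ψ (b ∷ w) ≡ 0
    ∑Ψ-∷≡0 = trans (sum-cong-≗ {n = r} (λ b → Ψ-finished (b ∷ w) (AllRuns-∷ b w runs)))
                   (trans (∑-const r 0) (*-zeroʳ r))

  ∑Ψ : ℕ → ℕ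
  ∑Ψ n = ∑words n Ψ

  ∑Ψ-suc : ∀ n → r * ∑Ψ n ≡ r * r ! * #unfinished n + ∑Ψ (suc n)
  ∑Ψ-suc n = begin
    r * ∑Ψ n
      ≡⟨ ∑words-*ˡ n r Ψ ⟨
    ∑words n (λ w → r * Ψ w)
      ≡⟨ ∑words-cong n (λ w _ → Ψ-step w) ⟩
    ∑words n (λ w → r * r ! * unfinished w + ∑[ b < r ] Ψ (b ∷ w))
      ≡⟨ ∑words-+ n _ _ ⟩
    ∑words n (λ w → r * r ! * unfinished w) + ∑Ψ (suc n)
      ≡⟨ cong (_+ ∑Ψ (suc n)) (∑words-*ˡ n (r * r !) unfinished) ⟩
    r * r ! * #unfinished n + ∑Ψ (suc n) ∎
    where open ≡-Reasoning

  ∑Ψ≤ : ∀ n → ∑Ψ n ≤ Ψ₀ * #unfinished n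
  ∑Ψ≤ n = ≤-trans (∑words-mono n (λ w _ → Ψ≤ w)) (≤-reflexive (∑words-*ˡ n Ψ₀ unfinished))
    where
    Ψ≤ : ∀ w → Ψ w ≤ Ψ₀ * unfinished w
    Ψ≤ w with allRuns? r h w
    ... | yes runs = ≤-trans (≤-reflexive (Ψ-finished w runs)) z≤n
    ... | no _     = ≤-trans (Ψ≤Ψ₀ w) (≤-reflexive (sym (*-identityʳ Ψ₀)))

  -- Each of the j steps of ∑Ψ-suc pays r! for every word that is still unfinished.
  ∑Ψ-markov : ∀ j m → r ! * (j * #unfinished (j + m)) + ∑Ψ (j + m) ≤ r ^ j * ∑Ψ m
  ∑Ψ-markov zero    m = ≤-reflexive (trans (cong (_+ ∑Ψ m) (*-zeroʳ (r !))) (sym (*-identityˡ (∑Ψ m))))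
  ∑Ψ-markov (suc j) m = begin
    r ! * (suc j * #unfinished (suc (j + m))) + ∑Ψ (suc (j + m))
      ≤⟨ +-monoˡ-≤ _ (*-monoʳ-≤ (r !) (*-monoʳ-≤ (suc j) (#unfinished-suc (j + m)))) ⟩
    r ! * (suc j * (r * B)) + ∑Ψ (suc (j + m))
      ≡⟨ regroup r (r !) j B (∑Ψ (suc (j + m))) ⟩
    r * (r ! * (j * B)) + (r * r ! * B + ∑Ψ (suc (j + m)))
      ≡⟨ cong (r * (r ! * (j * B)) +_) (∑Ψ-suc (j + m)) ⟨
    r * (r ! * (j * B)) + r * ∑Ψ (j + m)
      ≡⟨ *-distribˡ-+ r _ _ ⟨
    r * (r ! * (j * B) + ∑Ψ (j + m))
      ≤⟨ *-monoʳ-≤ r (∑Ψ-markov j m) ⟩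
    r * (r ^ j * ∑Ψ m)
      ≡⟨ *-assoc r (r ^ j) (∑Ψ m) ⟨
    r ^ suc j * ∑Ψ m ∎
    where
    open ≤-Reasoning
    B = #unfinished (j + m)
    regroup : ∀ r L j B S → L * (suc j * (r * B)) + S ≡ r * (L * (j * B)) + (r * L * B + S)
    regroup = solve-∀

  #unfinished-bound : ∀ n → r ! * (n * #unfinished n) ≤ Ψ₀ * r ^ n
  #unfinished-bound n = begin
    r ! * (n * #unfinished n)                       ≤⟨ m≤m+n _ (∑Ψ n) ⟩
    r ! * (n * #unfinished n) + ∑Ψ n
      ≡⟨ cong (λ k → r ! * (n * #unfinished k) + ∑Ψ k) (+-identityʳ n) ⟨
    r ! * (n * #unfinished (n + 0)) + ∑Ψ (n + 0)    ≤⟨ ∑Ψ-markov n 0 ⟩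
    r ^ n * ∑Ψ 0                                     ≡⟨ cong (r ^ n *_) Ψ-[] ⟩
    r ^ n * Ψ₀                                       ≡⟨ *-comm (r ^ n) Ψ₀ ⟩
    Ψ₀ * r ^ n                                       ∎
    where open ≤-Reasoning

  -- r! r^n times the difference between the expectation and the n-th partial sum of its series.
  remainder : ℕ → ℕ
  remainder n = ∑Ψ n + r ! * (n * #unfinished n)

  remainder-0 : remainder 0 ≡ Ψ₀
  remainder-0 = trans (cong (∑Ψ 0 +_) (*-zeroʳ (r !))) (trans (+-identityʳ (∑Ψ 0)) Ψ-[])

  remainder-suc : ∀ m → suc m * r ! * countStops r h (suc m) + remainder (suc m) ≡ r * remainder m
  remainder-suc m = begin
    suc m * r ! * stops + (∑Ψ (suc m) + r ! * (suc m * B′))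
      ≡⟨ e₁ m (r !) stops (∑Ψ (suc m)) B′ ⟩
    r ! * suc m * (stops + B′) + ∑Ψ (suc m)
      ≡⟨ cong (λ x → r ! * suc m * x + ∑Ψ (suc m)) (countStops-suc m) ⟩
    r ! * suc m * (r * B) + ∑Ψ (suc m)
      ≡⟨ e₂ r (r !) m B (∑Ψ (suc m)) ⟩
    r * (r ! * (m * B)) + (r * r ! * B + ∑Ψ (suc m))
      ≡⟨ cong (r * (r ! * (m * B)) +_) (∑Ψ-suc m) ⟨
    r * (r ! * (m * B)) + r * ∑Ψ m
      ≡⟨ e₃ r (∑Ψ m) (r ! * (m * B)) ⟩
    r * remainder m ∎
    where
    open ≡-Reasoning
    stops = countStops r h (suc m)
    B = #unfinished m
    B′ = #unfinished (suc m)
    e₁ : ∀ m L c S B → suc m * L * c + (S + L * (suc m * B)) ≡ L * suc m * (c + B) + S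
    e₁ = solve-∀
    e₂ : ∀ r L m B S → L * suc m * (r * B) + S ≡ r * (L * (m * B)) + (r * L * B + S)
    e₂ = solve-∀
    e₃ : ∀ r S X → r * X + r * S ≡ r * (S + X)
    e₃ = solve-∀

  -- The Markov bound from time j to time k + j, together with the bound on #unfinished j.
  remainder-halves : ∀ {j k} → j ≤ k → r ! * j * remainder (k + j) ≤ 2 * Ψ₀ * Ψ₀ * r ^ (k + j)
  remainder-halves {j} {k} j≤k = begin
    r ! * j * (S + r ! * ((k + j) * B))
      ≤⟨ *-monoʳ-≤ (r ! * j) early ⟩
    r ! * j * (2 * (r ! * (k * B) + S))
      ≤⟨ *-monoʳ-≤ (r ! * j) (*-monoʳ-≤ 2 (∑Ψ-markov k j)) ⟩
    r ! * j * (2 * (r ^ k * ∑Ψ j))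
      ≤⟨ *-monoʳ-≤ (r ! * j) (*-monoʳ-≤ 2 (*-monoʳ-≤ (r ^ k) (∑Ψ≤ j))) ⟩
    r ! * j * (2 * (r ^ k * (Ψ₀ * #unfinished j)))
      ≡⟨ e₁ (r !) j (r ^ k) Ψ₀ (#unfinished j) ⟩
    2 * Ψ₀ * r ^ k * (r ! * (j * #unfinished j))
      ≤⟨ *-monoʳ-≤ (2 * Ψ₀ * r ^ k) (#unfinished-bound j) ⟩
    2 * Ψ₀ * r ^ k * (Ψ₀ * r ^ j)
      ≡⟨ e₂ Ψ₀ (r ^ k) (r ^ j) ⟩
    2 * Ψ₀ * Ψ₀ * (r ^ k * r ^ j)
      ≡⟨ cong (2 * Ψ₀ * Ψ₀ *_) (^-distribˡ-+-* r k j) ⟨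
    2 * Ψ₀ * Ψ₀ * r ^ (k + j) ∎
    where
    open ≤-Reasoning
    S = ∑Ψ (k + j)
    B = #unfinished (k + j)
    early : S + r ! * ((k + j) * B) ≤ 2 * (r ! * (k * B) + S)
    early = begin
      S + r ! * ((k + j) * B)      ≤⟨ +-monoʳ-≤ S (*-monoʳ-≤ (r !) (*-monoˡ-≤ B (+-monoʳ-≤ k j≤k))) ⟩
      S + r ! * ((k + k) * B)      ≤⟨ m≤m+n _ S ⟩
      S + r ! * ((k + k) * B) + S  ≡⟨ e₀ S (r !) k B ⟩
      2 * (r ! * (k * B) + S)      ∎
      where
      e₀ : ∀ S L k B → S + L * ((k + k) * B) + S ≡ 2 * (L * (k * B) + S)
      e₀ = solve-∀
    e₁ : ∀ L j p P U → L * j * (2 * (p * (P * U))) ≡ 2 * P * p * (L * (j * U))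
    e₁ = solve-∀
    e₂ : ∀ P a b → 2 * P * a * (P * b) ≡ 2 * P * P * (a * b)
    e₂ = solve-∀

  remainder-decay : ∀ n → ⌊ n /2⌋ * remainder n ≤ 2 * Ψ₀ * Ψ₀ * (r ! * r ^ n)
  remainder-decay n = begin
    ⌊ n /2⌋ * remainder n               ≤⟨ m≤n*m _ (r !) {{r !≢0}} ⟩
    r ! * (⌊ n /2⌋ * remainder n)       ≡⟨ *-assoc (r !) _ _ ⟨
    r ! * ⌊ n /2⌋ * remainder n         ≡⟨ cong (λ m → r ! * ⌊ n /2⌋ * remainder m) n≡⌈n/2⌉+⌊n/2⌋ ⟩
    r ! * ⌊ n /2⌋ * remainder (⌈ n /2⌉ + ⌊ n /2⌋) ≤⟨ remainder-halves (⌊n/2⌋≤⌈n/2⌉ n) ⟩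
    2 * Ψ₀ * Ψ₀ * r ^ (⌈ n /2⌉ + ⌊ n /2⌋) ≡⟨ cong (λ m → 2 * Ψ₀ * Ψ₀ * r ^ m) n≡⌈n/2⌉+⌊n/2⌋ ⟨
    2 * Ψ₀ * Ψ₀ * r ^ n                  ≤⟨ *-monoʳ-≤ (2 * Ψ₀ * Ψ₀) (m≤n*m (r ^ n) (r !) {{r !≢0}}) ⟩
    2 * Ψ₀ * Ψ₀ * (r ! * r ^ n)          ∎
    where
    open ≤-Reasoning
    n≡⌈n/2⌉+⌊n/2⌋ : n ≡ ⌈ n /2⌉ + ⌊ n /2⌋
    n≡⌈n/2⌉+⌊n/2⌋ = sym (trans (+-comm ⌈ n /2⌉ ⌊ n /2⌋) (⌊n/2⌋+⌈n/2⌉≡n n))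

  #unfinished-decay : ∀ n → ⌊ n /2⌋ * #unfinished n ≤ Ψ₀ * r ^ n
  #unfinished-decay n = begin
    ⌊ n /2⌋ * #unfinished n      ≤⟨ *-monoˡ-≤ (#unfinished n) (⌊n/2⌋≤n n) ⟩
    n * #unfinished n            ≤⟨ m≤n*m _ (r !) {{r !≢0}} ⟩
    r ! * (n * #unfinished n)    ≤⟨ #unfinished-bound n ⟩
    Ψ₀ * r ^ n                   ∎
    where open ≤-Reasoning

-- Fractions and telescoping series

open import Data.Integer using (+_)

fromℚᵘ-+ : ∀ p q → fromℚᵘ (p ℚᵘ.+ q) ≡ fromℚᵘ p +ℚ fromℚᵘ q
fromℚᵘ-+ p q = ℚ.toℚᵘ-injective (ℚᵘ.≃-trans (ℚ.toℚᵘ-fromℚᵘ _)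
  (ℚᵘ.≃-sym (ℚᵘ.≃-trans (ℚ.toℚᵘ-homo-+ (fromℚᵘ p) (fromℚᵘ q)) (ℚᵘ.+-cong (ℚ.toℚᵘ-fromℚᵘ p) (ℚ.toℚᵘ-fromℚᵘ q)))))

fromℚᵘ-* : ∀ p q → fromℚᵘ (p ℚᵘ.* q) ≡ fromℚᵘ p *ℚ fromℚᵘ q
fromℚᵘ-* p q = ℚ.toℚᵘ-injective (ℚᵘ.≃-trans (ℚ.toℚᵘ-fromℚᵘ _)
  (ℚᵘ.≃-sym (ℚᵘ.≃-trans (ℚ.toℚᵘ-homo-* (fromℚᵘ p) (fromℚᵘ q)) (ℚᵘ.*-cong (ℚ.toℚᵘ-fromℚᵘ p) (ℚ.toℚᵘ-fromℚᵘ q)))))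

+a/d++b/e≡+c/f : ∀ a b c d e f .{{_ : NonZero d}} .{{_ : NonZero e}} .{{_ : NonZero f}} →
                 (a * e + b * d) * f ≡ c * (d * e) → + a /ℚ d +ℚ + b /ℚ e ≡ + c /ℚ f
+a/d++b/e≡+c/f a b c (suc d) (suc e) (suc f) eq = trans (sym (fromℚᵘ-+ (mkℚᵘ (+ a) d) (mkℚᵘ (+ b) e)))
  (ℚ.fromℚᵘ-cong {mkℚᵘ (+ a) d ℚᵘ.+ mkℚᵘ (+ b) e} {mkℚᵘ (+ c) f} (*≡* (begin
    (+ a ℤ.* + suc e ℤ.+ + b ℤ.* + suc d) ℤ.* + suc f
      ≡⟨ cong (ℤ._* + suc f) (cong₂ ℤ._+_ (ℤ.pos-* a (suc e)) (ℤ.pos-* b (suc d))) ⟨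
    + (a * suc e + b * suc d) ℤ.* + suc f  ≡⟨ ℤ.pos-* (a * suc e + b * suc d) (suc f) ⟨
    + ((a * suc e + b * suc d) * suc f)    ≡⟨ cong +_ eq ⟩
    + (c * (suc d * suc e))                ≡⟨ ℤ.pos-* c _ ⟩
    + c ℤ.* + (suc d * suc e)              ∎)))
  where open ≡-Reasoning

+a/d*+b/e≡+c/f : ∀ a b c d e f .{{_ : NonZero d}} .{{_ : NonZero e}} .{{_ : NonZero f}} →
                 a * b * f ≡ c * (d * e) → (+ a /ℚ d) *ℚ (+ b /ℚ e) ≡ + c /ℚ f
+a/d*+b/e≡+c/f a b c (suc d) (suc e) (suc f) eq = trans (sym (fromℚᵘ-* (mkℚᵘ (+ a) d) (mkℚᵘ (+ b) e)))
  (ℚ.fromℚᵘ-cong {mkℚᵘ (+ a) d ℚᵘ.* mkℚᵘ (+ b) e} {mkℚᵘ (+ c) f} (*≡* (begin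
    + a ℤ.* + b ℤ.* + suc f     ≡⟨ cong (ℤ._* + suc f) (ℤ.pos-* a b) ⟨
    + (a * b) ℤ.* + suc f       ≡⟨ ℤ.pos-* (a * b) (suc f) ⟨
    + (a * b * suc f)           ≡⟨ cong +_ eq ⟩
    + (c * (suc d * suc e))     ≡⟨ ℤ.pos-* c _ ⟩
    + c ℤ.* + (suc d * suc e)   ∎)))
  where open ≡-Reasoning

0≤+a/d : ∀ a d .{{_ : NonZero d}} → 0ℚ ≤ℚ + a /ℚ d
0≤+a/d a d = ℚ.nonNegative⁻¹ _ {{ℚ.normalize-nonNeg a d}}

+a/d<mkℚ : ∀ a d k dd .{{_ : NonZero d}} .{c : Coprime (suc k) (suc dd)} →
           a * suc dd < suc k * d → + a /ℚ d <ℚ mkℚ (+ suc k) dd c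
+a/d<mkℚ a (suc d) k dd a*dd<k*d = ℚ.toℚᵘ-cancel-< (ℚᵘ.<-respˡ-≃ (ℚᵘ.≃-sym (ℚ.toℚᵘ-fromℚᵘ (mkℚᵘ (+ a) d)))
  (*<* (subst₂ ℤ._<_ (ℤ.pos-* a (suc dd)) (ℤ.pos-* (suc k) (suc d)) (ℤ.+<+ a*dd<k*d))))

eventually-< : ∀ {a d C s m} .{{_ : NonZero d}} →
               ⌊ m /2⌋ * a ≤ C * d → suc (C * s) + suc (C * s) ≤ m → a * s < d
eventually-< {a} {d} {C} {s} {m} half≤ 2K≤m = *-cancelˡ-< ⌊ m /2⌋ (a * s) d (begin-strict
  ⌊ m /2⌋ * (a * s)     ≡⟨ *-assoc ⌊ m /2⌋ a s ⟨
  ⌊ m /2⌋ * a * s       ≤⟨ *-monoˡ-≤ s half≤ ⟩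
  C * d * s             ≡⟨ e C d s ⟩
  C * s * d             <⟨ *-monoˡ-< d K<half ⟩
  ⌊ m /2⌋ * d           ∎)
  where
  open ≤-Reasoning
  K<half : C * s < ⌊ m /2⌋
  K<half = ≤-trans (≤-reflexive (n≡⌊n+n/2⌋ (suc (C * s)))) (⌊n/2⌋-mono 2K≤m)
  e : ∀ C d s → C * d * s ≡ C * s * d
  e = solve-∀

partialSum-telescope : ∀ (f ρ : ℕ → ℚ) → (∀ n → f (suc n) +ℚ ρ (suc n) ≡ ρ n) →
                       ∀ n → partialSum f (suc n) +ℚ ρ n ≡ partialSum f 1 +ℚ ρ 0
partialSum-telescope f ρ step zero    = refl
partialSum-telescope f ρ step (suc n) = begin
  partialSum f (suc n) +ℚ f (suc n) +ℚ ρ (suc n)    ≡⟨ ℚ.+-assoc (partialSum f (suc n)) _ _ ⟩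
  partialSum f (suc n) +ℚ (f (suc n) +ℚ ρ (suc n))  ≡⟨ cong (partialSum f (suc n) +ℚ_) (step n) ⟩
  partialSum f (suc n) +ℚ ρ n                       ≡⟨ partialSum-telescope f ρ step n ⟩
  partialSum f 1 +ℚ ρ 0                             ∎
  where open ≡-Reasoning

x+y≡z⇒∣x-z∣≡y : ∀ {x y z} → 0ℚ ≤ℚ y → x +ℚ y ≡ z → ∣ x -ℚ z ∣ ≡ y
x+y≡z⇒∣x-z∣≡y {x} {y} 0≤y refl = begin
  ∣ x -ℚ (x +ℚ y) ∣  ≡⟨ cong ∣_∣ (solve 2 (λ x y → x :- (x :+ y) := :- y) refl x y) ⟩
  ∣ -ℚ y ∣           ≡⟨ ℚ.∣-p∣≡∣p∣ y ⟩
  ∣ y ∣              ≡⟨ ℚ.0≤p⇒∣p∣≡p 0≤y ⟩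
  y                  ∎
  where
  open ≡-Reasoning
  open +-*-Solver

seriesSumsTo-byRemainder : ∀ (f : ℕ → ℚ) S (a d : ℕ → ℕ) (d≢0 : ∀ n → NonZero (d n)) C →
  let ρ = λ n → (+ a n /ℚ d n) {{d≢0 n}} in
  partialSum f 1 +ℚ ρ 0 ≡ S → (∀ n → f (suc n) +ℚ ρ (suc n) ≡ ρ n) →
  (∀ n → ⌊ n /2⌋ * a n ≤ C * d n) → SeriesSumsTo f S
seriesSumsTo-byRemainder f S a d d≢0 C base step decay (mkℚ (+ suc k) dd _) _ = suc (K + K) , close
  where
  K = suc (C * suc dd)
  close : ∀ n → suc (K + K) ≤ n → ∣ partialSum f n -ℚ S ∣ <ℚ mkℚ (+ suc k) dd _
  close (suc m) (s≤s 2K≤m) = subst (_<ℚ _)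
    (sym (x+y≡z⇒∣x-z∣≡y {x = partialSum f (suc m)} (0≤+a/d (a m) (d m) {{d≢0 m}})
                         (trans (partialSum-telescope f _ step m) base)))
    (+a/d<mkℚ (a m) (d m) k dd {{d≢0 m}}
      (<-≤-trans (eventually-< {C = C} {s = suc dd} {{d≢0 m}} (decay m) 2K≤m) (m≤n*m (d m) (suc k))))
seriesSumsTo-byRemainder f S a d d≢0 C base step decay (mkℚ (+ zero)   _ _) (ℚ.*<* (ℤ.+<+ ()))
seriesSumsTo-byRemainder f S a d d≢0 C base step decay (mkℚ ℤ.-[1+ _ ] _ _) (ℚ.*<* ())

-- The two series

module Series (r h : ℕ) .{{_ : NonZero r}} .{{_ : NonZero h}} where

  open Unfinished r h
  open Potential r h

  instance
    r!≢0 : NonZero (r !)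
    r!≢0 = r !≢0

  1≤r : 1 ≤ r
  1≤r = >-nonZero⁻¹ r

  harmonic≡ : ∀ {u} → u ≤ r → harmonic u ≡ + harm u /ℚ r !
  harmonic≡ {zero}  _   = sym (ℚ.0/n≡0 (r !))
  harmonic≡ {suc u} u<r = begin
    harmonic u +ℚ + 1 /ℚ suc u         ≡⟨ cong (_+ℚ + 1 /ℚ suc u) (harmonic≡ (<⇒≤ u<r)) ⟩
    + harm u /ℚ r ! +ℚ + 1 /ℚ suc u    ≡⟨ +a/d++b/e≡+c/f (harm u) 1 (harm (suc u)) (r !) (suc u) (r !) cross ⟩
    + harm (suc u) /ℚ r !              ∎
    where
    open ≡-Reasoning
    cross : (harm u * suc u + 1 * r !) * r ! ≡ harm (suc u) * (r ! * suc u)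
    cross = begin
      (harm u * suc u + 1 * r !) * r !
        ≡⟨ cong (λ x → (harm u * suc u + 1 * x) * r !) (*-inv (s≤s z≤n) u<r) ⟨
      (harm u * suc u + 1 * (suc u * inv (suc u))) * r !
        ≡⟨ e (harm u) (suc u) (inv (suc u)) (r !) ⟩
      (harm u + inv (suc u)) * (r ! * suc u) ∎
      where
      e : ∀ H u c L → (H * u + 1 * (u * c)) * L ≡ (H + c) * (L * u)
      e = solve-∀

  module AtTime (n : ℕ) where

    instance
      r^n≢0 : NonZero (r ^ n)
      r^n≢0 = m^n≢0 r n
      r^1+n≢0 : NonZero (r ^ suc n)
      r^1+n≢0 = m^n≢0 r (suc n)
      r!*r^n≢0 : NonZero (r ! * r ^ n)
      r!*r^n≢0 = m*n≢0 (r !) (r ^ n)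
      r!*r^1+n≢0 : NonZero (r ! * r ^ suc n)
      r!*r^1+n≢0 = m*n≢0 (r !) (r ^ suc n)

    probability-step : probB r h (suc n) +ℚ + #unfinished (suc n) /ℚ r ^ suc n ≡ + #unfinished n /ℚ r ^ n
    probability-step = +a/d++b/e≡+c/f (countStops r h (suc n)) (#unfinished (suc n)) (#unfinished n)
                                      (r ^ suc n) (r ^ suc n) (r ^ n) (begin
      (stops * D + B′ * D) * p    ≡⟨ e₁ stops B′ D p ⟩
      (stops + B′) * D * p        ≡⟨ cong (λ x → x * D * p) (countStops-suc n) ⟩
      r * B * D * p               ≡⟨ e₂ r B D p ⟩
      B * (D * (r * p))           ∎)
      where
      open ≡-Reasoning
      stops = countStops r h (suc n)
      B = #unfinished n
      B′ = #unfinished (suc n)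
      p = r ^ n
      D = r ^ suc n
      e₁ : ∀ a b D p → (a * D + b * D) * p ≡ (a + b) * D * p
      e₁ = solve-∀
      e₂ : ∀ r B D p → r * B * D * p ≡ B * (D * (r * p))
      e₂ = solve-∀

    expectation-step : (+ suc n /ℚ 1) *ℚ probB r h (suc n) +ℚ + remainder (suc n) /ℚ (r ! * r ^ suc n)
                       ≡ + remainder n /ℚ (r ! * r ^ n)
    expectation-step = begin
      (+ suc n /ℚ 1) *ℚ (+ stops /ℚ D) +ℚ + X′ /ℚ (r ! * D)
        ≡⟨ cong (_+ℚ + X′ /ℚ (r ! * D)) (+a/d*+b/e≡+c/f (suc n) stops (suc n * stops) 1 D D
                                           (cong (suc n * stops *_) (sym (*-identityˡ D)))) ⟩
      + (suc n * stops) /ℚ D +ℚ + X′ /ℚ (r ! * D)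
        ≡⟨ +a/d++b/e≡+c/f (suc n * stops) X′ X D (r ! * D) (r ! * p) cross ⟩
      + X /ℚ (r ! * p) ∎
      where
      open ≡-Reasoning
      stops = countStops r h (suc n)
      X = remainder n
      X′ = remainder (suc n)
      p = r ^ n
      D = r ^ suc n
      cross : (suc n * stops * (r ! * D) + X′ * D) * (r ! * p) ≡ X * (D * (r ! * D))
      cross = begin
        (suc n * stops * (r ! * D) + X′ * D) * (r ! * p) ≡⟨ e₁ n stops (r !) D X′ (r ! * p) ⟩
        (suc n * r ! * stops + X′) * (D * (r ! * p))      ≡⟨ cong (_* (D * (r ! * p))) (remainder-suc n) ⟩
        r * X * (D * (r ! * p))                           ≡⟨ e₂ r X (r !) p ⟩
        X * (D * (r ! * D))                               ∎
        where
        e₁ : ∀ n s L D X′ q → (suc n * s * (L * D) + X′ * D) * q ≡ (suc n * L * s + X′) * (D * q)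
        e₁ = solve-∀
        e₂ : ∀ r X L p → r * X * (r * p * (L * p)) ≡ X * (r * p * (L * (r * p)))
        e₂ = solve-∀

  probabilities : SeriesSumsTo (λ n → probB r h n) 1ℚ
  probabilities = seriesSumsTo-byRemainder _ 1ℚ #unfinished (r ^_) (λ n → m^n≢0 r n) Ψ₀
                    base AtTime.probability-step #unfinished-decay
    where
    base : 0ℚ +ℚ probB r h 0 +ℚ + #unfinished 0 /ℚ 1 ≡ 1ℚ
    base = cong₂ (λ c u → 0ℚ +ℚ + c /ℚ 1 +ℚ + u /ℚ 1) (countStops-0 1≤r 1≤h) (#unfinished-0 1≤r 1≤h)

  expectation : .{{_ : NonZero (r ∸ 1)}} →
    SeriesSumsTo (λ n → (+ n /ℚ 1) *ℚ probB r h n) (((+ (r * (r ^ h ∸ 1))) /ℚ (r ∸ 1)) *ℚ harmonic r)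
  expectation = seriesSumsTo-byRemainder _ _ remainder (λ n → r ! * r ^ n) (λ n → AtTime.r!*r^n≢0 n)
                  (2 * Ψ₀ * Ψ₀) base AtTime.expectation-step remainder-decay
    where
    open AtTime 0 using (r!*r^n≢0)
    open ≡-Reasoning
    cross : r * (r ^ h ∸ 1) * harm r * (r ! * 1) ≡ Ψ₀ * ((r ∸ 1) * r !)
    cross = begin
      r * (r ^ h ∸ 1) * harm r * (r ! * 1)   ≡⟨ cong (λ x → x * harm r * (r ! * 1)) R₀*[r∸1] ⟨
      R₀ * (r ∸ 1) * harm r * (r ! * 1)      ≡⟨ e R₀ (r ∸ 1) (harm r) (r !) ⟩
      R₀ * harm r * ((r ∸ 1) * r !)          ∎
      where
      e : ∀ R s H L → R * s * H * (L * 1) ≡ R * H * (s * L)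
      e = solve-∀
    base : 0ℚ +ℚ (+ 0 /ℚ 1) *ℚ probB r h 0 +ℚ + remainder 0 /ℚ (r ! * 1)
           ≡ ((+ (r * (r ^ h ∸ 1))) /ℚ (r ∸ 1)) *ℚ harmonic r
    base = begin
      0ℚ +ℚ (+ 0 /ℚ 1) *ℚ probB r h 0 +ℚ + remainder 0 /ℚ (r ! * 1)
        ≡⟨ cong (λ x → 0ℚ +ℚ x +ℚ + remainder 0 /ℚ (r ! * 1)) (ℚ.*-zeroˡ (probB r h 0)) ⟩
      0ℚ +ℚ 0ℚ +ℚ + remainder 0 /ℚ (r ! * 1)
        ≡⟨ ℚ.+-identityˡ _ ⟩
      + remainder 0 /ℚ (r ! * 1)
        ≡⟨ cong (λ x → + x /ℚ (r ! * 1)) remainder-0 ⟩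
      + Ψ₀ /ℚ (r ! * 1)
        ≡⟨ +a/d*+b/e≡+c/f (r * (r ^ h ∸ 1)) (harm r) Ψ₀ (r ∸ 1) (r !) (r ! * 1) cross ⟨
      (+ (r * (r ^ h ∸ 1)) /ℚ (r ∸ 1)) *ℚ (+ harm r /ℚ r !)
        ≡⟨ cong ((+ (r * (r ^ h ∸ 1)) /ℚ (r ∸ 1)) *ℚ_) (harmonic≡ ≤-refl) ⟨
      (+ (r * (r ^ h ∸ 1)) /ℚ (r ∸ 1)) *ℚ harmonic r ∎

corollary4 : (r h : ℕ) → 2 ≤ r → 1 ≤ h →
    .{{_ : NonZero r}} → .{{_ : NonZero (r ∸ 1)}} →
    SeriesSumsTo (λ n → probB r h n) 1ℚ
    × SeriesSumsTo (λ n → (+ n /ℚ 1) *ℚ probB r h n)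
        (((+ (r * (r ^ h ∸ 1))) /ℚ (r ∸ 1)) *ℚ harmonic r)
corollary4 r h _ 1≤h = probabilities , expectation
  where
  instance
    h≢0 : NonZero h
    h≢0 = ℕ.>-nonZero 1≤h
  open Series r h
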